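{- For every graph $G$, $\mathrm{VCdim}(G)\le 8\,\mathrm{fw}_1(G)$ and $\mathrm{2VCdim}(G)\le 8\,\mathrm{fw}_2(G)+2$.
   Context: Graphs are finite, undirected, without loops; $N(v)$ is the open neighborhood. $\mathrm{VCdim}(G)$ is the maximum size of $X\subseteq V(G)$ with $\{N(v)\cap X: v\in V(G)\}=2^X$. $\mathrm{2VCdim}(G)$ is the maximum size of $X\subseteq V(G)$ such that for every two distinct $a,b\in X$ there is $c\in V(G)$ with $N(c)\cap X=\{a,b\}$. Flips: for $A,B\subseteq V(G)$, flipping $(A,B)$ inverts adjacency of every pair of distinct vertices $a\in A,b\in B$. A $\mathcal P$-flip of $G$, for a partition $\mathcal P$ of $V(G)$, is obtained by flipping some pairs of parts of $\mathcal P$ (possibly a part with itself); a $k$-flip is a $\mathcal P$-flip with $|\mathcal P|\le k$. Flipper game of radius $r$ and width $k$: $G_0=G$, the runner picks $v_0$; in round $i\ge1$ the flipper announces a $k$-flip $G_i$ of $G$, and the runner moves from $v_{i-1}$ to some $v_i$ joined by a path of length at most $r$ (possibly $0$) in $G_{i-1}$; the flipper wins when $v_i$ is isolated in $G_i$. $\mathrm{fw}_r(G)$ is the least $k$ for which the flipper has a winning strategy. -}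

module Defs where

open import Data.Nat using (ℕ; zero; suc)
open import Data.Bool using (Bool; true; false; if_then_else_; _xor_)
open import Data.Fin using (Fin; _≟_)
open import Data.Fin.Subset using (Subset; _∩_; _∪_; _⊆_; _∈_; ⁅_⁆)
open import Data.Vec using (tabulate)
open import Data.Sum using (_⊎_)
open import Data.Product using (Σ; ∃; _×_)
open import Relation.Nullary using (¬_)
open import Relation.Nullary.Decidable using (⌊_⌋)
open import Relation.Binary.PropositionalEquality using (_≡_)

record Graph : Set where
  field
    n     : ℕ
    adj   : Fin n → Fin n → Bool
    sym   : ∀ u v → adj u v ≡ adj v u
    loopless : ∀ v → adj v v ≡ false
open Graph public

N : (G : Graph) → Fin (n G) → Subset (n G)
N G v = tabulate (adj G v)

Shattered : (G : Graph) → Subset (n G) → Set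
Shattered G X = ∀ (Y : Subset (n G)) → Y ⊆ X → ∃ λ v → N G v ∩ X ≡ Y

TwoShattered : (G : Graph) → Subset (n G) → Set
TwoShattered G X = ∀ a b → a ∈ X → b ∈ X → ¬ (a ≡ b) →
  ∃ λ c → N G c ∩ X ≡ (⁅ a ⁆ ∪ ⁅ b ⁆)

-- A k-flip of G: a partition P of V(G) into at most k parts, given by a
-- colouring col : V(G) → Fin k (parts = nonempty colour classes), together
-- with a symmetric choice fl of which (unordered, possibly equal) pairs of
-- parts are flipped.
record KFlip (G : Graph) (k : ℕ) : Set where
  field
    col    : Fin (n G) → Fin k
    fl     : Fin k → Fin k → Bool
    fl-sym : ∀ i j → fl i j ≡ fl j i
open KFlip public

flipAdj : (G : Graph) {k : ℕ} → KFlip G k → Fin (n G) → Fin (n G) → Bool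
flipAdj G F u v =
  if ⌊ u ≟ v ⌋ then false else (adj G u v xor fl F (col F u) (col F v))

-- Walk of length at most r from u to w in the graph with adjacency H.
data Walk {m : ℕ} (H : Fin m → Fin m → Bool) : ℕ → Fin m → Fin m → Set where
  stay : ∀ {r u} → Walk H r u u
  step : ∀ {r u v w} → H u v ≡ true → Walk H r v w → Walk H (suc r) u w

Isolated : {m : ℕ} → (Fin m → Fin m → Bool) → Fin m → Set
Isolated H v = ∀ u → H v u ≡ false

-- FlipperWinsFrom G r k H v : in the flipper game of radius r and width k on
-- G, when the current graph is H (= G_{i-1}) and the runner is at v
-- (= v_{i-1}), the flipper can force a win (in finitely many rounds):
-- he announces a k-flip G_i of G such that for every runner move v_i
-- (reachable from v by a path of length ≤ r in H), either v_i is isolated in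
-- G_i or the flipper again can force a win from (G_i, v_i).
data FlipperWinsFrom (G : Graph) (r k : ℕ)
     (H : Fin (n G) → Fin (n G) → Bool) (v : Fin (n G)) : Set where
  announce : (F : KFlip G k) →
    (∀ w → Walk H r v w →
       Isolated (flipAdj G F) w ⊎ FlipperWinsFrom G r k (flipAdj G F) w) →
    FlipperWinsFrom G r k H v

FlipperWins : (r k : ℕ) → Graph → Set
FlipperWins r k G = ∀ v₀ → FlipperWinsFrom G r k (adj G) v₀

-- The runner keeps an invariant that no announced flip can destroy.
--
-- Radius 1, X shattered, |X| > 8k: for every k-colouring c the runner has a neighbour that
-- splits k + 2 disjoint c-monochromatic pairs of X (is adjacent to exactly one vertex of each),
-- or the runner has k + 1 neighbours in X.  A splitter for the partition of the next flip still
-- splits after it, which leaves it k + 1 neighbours in X.  Among k + 1 neighbours two, z and z′,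
-- lie in one part; the other 8k − 1 vertices of X carry enough disjoint monochromatic pairs to
-- obtain, by shattering, two splitters adjacent to z but not to z′, and after the flip one of
-- them is adjacent to z or to z′.
--
-- Radius 2, X 2-shattered, |X| > 8k + 2: the runner has k + 1 vertices of X within distance 2.
-- Two of them, u and u′, lie in one part.  The witness of {u, v} stays adjacent to u or to u′, so
-- among any three vertices of X in one part one stays within distance 2 of u or u′.  Hence at
-- most 3k + 1 vertices of X are not, and k + 1 of the others are close to the same one of them.

module Submission where

open import Defs renaming (sym to adj-sym)
open import Data.Nat using (ℕ; zero; suc; _+_; _*_; _≤_; _<_; s≤s; z≤n; _≤?_)
open import Data.Nat.Properties
  using (≤-refl; ≤-reflexive; ≤-trans; ≤-pred; ≰⇒>; m≤m+n; m≤n+m; m≤n*m; +-comm; +-suc; *-suc;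
         +-monoˡ-≤; +-monoʳ-≤; +-cancelˡ-≤; +-cancelʳ-≤; module ≤-Reasoning)
open import Data.Nat.Tactic.RingSolver using (solve-∀)
open import Data.Bool using (Bool; true; false; _xor_; _∨_; _∧_; if_then_else_)
open import Data.Bool.Properties using (∧-identityʳ; ∨-zeroʳ; ¬-not) renaming (_≟_ to _≟ᵇ_)
open import Data.Fin using (Fin; zero; suc; _≟_; combine)
open import Data.Fin.Properties using (pigeonhole; <⇒≢; combine-injective; suc-injective; any?)
open import Data.Fin.Subset using (Subset; ∣_∣; _∩_; _∪_; ⁅_⁆) renaming (_∈_ to _∈ₛ_; _⊆_ to _⊆ₛ_)
open import Data.Fin.Subset.Properties using (x∈⁅x⁆; x∈⁅y⁆⇒x≡y; x∈p∪q⁺; x∈p∪q⁻)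
open import Data.List using (List; []; _∷_; length; lookup; filter; map; _++_)
open import Data.List.Properties using (length-map; filter-accept; filter-reject; filter-all)
open import Data.List.Membership.Propositional using (_∈_; _∉_)
open import Data.List.Membership.Propositional.Properties
  using (∈-lookup; ∈-filter⁻; ∈-map⁺; ∈-map⁻; ∈-++⁺ˡ; ∈-++⁺ʳ; ∈-++⁻)
open import Data.List.Relation.Binary.Subset.Propositional using (_⊆_)
open import Data.List.Relation.Unary.All as All using (All; []; _∷_)
open import Data.List.Relation.Unary.All.Properties using (++⁻ˡ)
open import Data.List.Relation.Unary.Any using (here; there)
open import Data.List.Relation.Unary.AllPairs using ([]; _∷_)
open import Data.List.Relation.Unary.Unique.Propositional using (Unique)
open import Data.List.Relation.Unary.Unique.Propositional.Properties using (map⁺; filter⁺)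
open import Data.Vec as Vec using ([]; _∷_; here; there; tabulate)
open import Data.Vec.Properties using (lookup∘tabulate; lookup-zipWith; []=⇒lookup; lookup⇒[]=)
open import Data.Product using (∃; ∃₂; _×_; _,_; proj₁; proj₂)
open import Data.Sum using (_⊎_; inj₁; inj₂; [_,_]′)
import Data.Sum as Sum
open import Data.Empty using (⊥; ⊥-elim)
open import Function using (_∘_)
open import Relation.Nullary using (¬_; Dec; does; yes; no; ¬?; _×-dec_; _⊎-dec_)
import Relation.Nullary.Decidable as Dec
open import Relation.Nullary.Decidable using (dec-true; dec-false)
open import Relation.Unary using (Decidable)
open import Relation.Unary.Properties using (∁?)
open import Relation.Binary.Definitions using (DecidableEquality)
open import Relation.Binary.PropositionalEquality
  using (_≡_; _≢_; refl; sym; ≢-sym; trans; cong; cong₂; subst; module ≡-Reasoning)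

private variable
  A : Set
  k : ℕ

lookup-injective : {xs : List A} → Unique xs → ∀ {i j} → lookup xs i ≡ lookup xs j → i ≡ j
lookup-injective (_ ∷ _) {zero} {zero} _ = refl
lookup-injective (x∉ ∷ _) {zero} {suc j} eq = ⊥-elim (All.lookup x∉ (∈-lookup j) eq)
lookup-injective (x∉ ∷ _) {suc i} {zero} eq = ⊥-elim (All.lookup x∉ (∈-lookup i) (sym eq))
lookup-injective (_ ∷ u) {suc i} {suc j} eq = cong suc (lookup-injective u eq)

sameColourPair : (col : A → Fin k) {xs : List A} → Unique xs → k < length xs →
  ∃₂ λ a b → a ∈ xs × b ∈ xs × a ≢ b × col a ≡ col b
sameColourPair col {xs} u k<n with i , j , i<j , same ← pigeonhole k<n (col ∘ lookup xs) =
  lookup xs i , lookup xs j , ∈-lookup i , ∈-lookup j ,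
  (λ eq → <⇒≢ i<j (lookup-injective u eq)) , same

distinctPair : {xs : List A} → Unique xs → 2 ≤ length xs → ∃₂ λ a b → a ∈ xs × b ∈ xs × a ≢ b
distinctPair ((a≢b ∷ _) ∷ _) (s≤s (s≤s _)) = _ , _ , here refl , there (here refl) , a≢b

Unique-++⁻ˡ : ∀ (xs : List A) {ys} → Unique (xs ++ ys) → Unique xs
Unique-++⁻ˡ []       _        = []
Unique-++⁻ˡ (x ∷ xs) (x∉ ∷ u) = ++⁻ˡ xs x∉ ∷ Unique-++⁻ˡ xs u

Unique-++⁻ʳ : ∀ (xs : List A) {ys} → Unique (xs ++ ys) → Unique ys
Unique-++⁻ʳ []       u       = u
Unique-++⁻ʳ (x ∷ xs) (_ ∷ u) = Unique-++⁻ʳ xs u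

Unique-++-⊆ʳ : ∀ (xs : List A) {ys zs} → Unique (xs ++ ys) → Unique zs → zs ⊆ ys →
  Unique (xs ++ zs)
Unique-++-⊆ʳ []       _        u zs⊆ys = u
Unique-++-⊆ʳ (x ∷ xs) (x∉ ∷ u) v zs⊆ys =
  All.tabulate (λ m → All.lookup x∉ (mono m)) ∷ Unique-++-⊆ʳ xs u v zs⊆ys
  where
  mono : xs ++ _ ⊆ xs ++ _
  mono m with ∈-++⁻ xs m
  ... | inj₁ m₁ = ∈-++⁺ˡ m₁
  ... | inj₂ m₂ = ∈-++⁺ʳ xs (zs⊆ys m₂)

flat : List (A × A) → List A
flat []             = []
flat ((a , b) ∷ ps) = a ∷ b ∷ flat ps

flat-++ : (ps qs : List (A × A)) → flat (ps ++ qs) ≡ flat ps ++ flat qs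
flat-++ []             qs = refl
flat-++ ((a , b) ∷ ps) qs = cong (λ l → a ∷ b ∷ l) (flat-++ ps qs)

∈-flat⁺ : ∀ {a b : A} {ps} → (a , b) ∈ ps → a ∈ flat ps × b ∈ flat ps
∈-flat⁺ (here refl) = here refl , there (here refl)
∈-flat⁺ {ps = _ ∷ _} (there m) with a∈ , b∈ ← ∈-flat⁺ m = there (there a∈) , there (there b∈)

∈-flat⁻ : ∀ {t : A} ps → t ∈ flat ps → ∃ λ p → p ∈ ps × (t ≡ proj₁ p ⊎ t ≡ proj₂ p)
∈-flat⁻ (p ∷ ps) (here refl)         = p , here refl , inj₁ refl
∈-flat⁻ (p ∷ ps) (there (here refl)) = p , here refl , inj₂ refl
∈-flat⁻ (p ∷ ps) (there (there m)) with q , q∈ , t≡ ← ∈-flat⁻ ps m = q , there q∈ , t≡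

flat-⊆ : {ps qs : List (A × A)} → ps ⊆ qs → flat ps ⊆ flat qs
flat-⊆ {ps = ps} ps⊆qs m with _ , p∈ , t≡ ← ∈-flat⁻ ps m with ∈-flat⁺ (ps⊆qs p∈) | t≡
... | a∈ , _ | inj₁ refl = a∈
... | _ , b∈ | inj₂ refl = b∈

firsts⊆flat : (ps : List (A × A)) → map proj₁ ps ⊆ flat ps
firsts⊆flat (_ ∷ ps) (here refl) = here refl
firsts⊆flat (_ ∷ ps) (there m)   = there (there (firsts⊆flat ps m))

seconds⊆flat : (ps : List (A × A)) → map proj₂ ps ⊆ flat ps
seconds⊆flat (_ ∷ ps) (here refl) = there (here refl)
seconds⊆flat (_ ∷ ps) (there m)   = there (there (seconds⊆flat ps m))

partner-∉ : ∀ {a b : A} {ps} → Unique (flat ps) → (a , b) ∈ ps →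
  b ∉ map proj₁ ps × a ∉ map proj₂ ps
partner-∉ {ps = (a , b) ∷ ps} ((a≢b ∷ a∉) ∷ b∉ ∷ _) (here refl) =
  (λ { (here b≡a) → a≢b (sym b≡a) ; (there m) → All.lookup b∉ (firsts⊆flat ps m) refl }) ,
  (λ { (here a≡b) → a≢b a≡b ; (there m) → All.lookup a∉ (seconds⊆flat ps m) refl })
partner-∉ {ps = (a' , b') ∷ ps} ((_ ∷ a'∉) ∷ b'∉ ∷ u) (there m)
  with b∉ , a∉ ← partner-∉ u m | a∈ , b∈ ← ∈-flat⁺ m =
  (λ { (here refl) → All.lookup a'∉ b∈ refl ; (there m') → b∉ m' }) ,
  (λ { (here refl) → All.lookup b'∉ a∈ refl ; (there m') → a∉ m' })

Unique-firsts : (ps : List (A × A)) → Unique (flat ps) → Unique (map proj₁ ps)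
Unique-firsts []             _                 = []
Unique-firsts ((a , b) ∷ ps) ((_ ∷ a∉) ∷ _ ∷ u) =
  All.tabulate (λ m → All.lookup a∉ (firsts⊆flat ps m)) ∷ Unique-firsts ps u

module _ (pick : A × A → A) (pick∈ : ∀ p → pick p ≡ proj₁ p ⊎ pick p ≡ proj₂ p) where

  choice⊆flat : ∀ ps → map pick ps ⊆ flat ps
  choice⊆flat ps m with p , p∈ , refl ← ∈-map⁻ pick m with ∈-flat⁺ p∈ | pick∈ p
  ... | a∈ , _ | inj₁ eq = subst (_∈ flat ps) (sym eq) a∈
  ... | _ , b∈ | inj₂ eq = subst (_∈ flat ps) (sym eq) b∈

  Unique-choice : ∀ ps → Unique (flat ps) → Unique (map pick ps)
  Unique-choice []             _                 = []
  Unique-choice ((a , b) ∷ ps) ((_ ∷ a∉) ∷ b∉ ∷ u) = All.tabulate fresh ∷ Unique-choice ps u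
    where
    fresh : ∀ {x} → x ∈ map pick ps → pick (a , b) ≢ x
    fresh m eq with pick∈ (a , b)
    ... | inj₁ eq′ = All.lookup a∉ (choice⊆flat ps m) (trans (sym eq′) eq)
    ... | inj₂ eq′ = All.lookup b∉ (choice⊆flat ps m) (trans (sym eq′) eq)

length-filter+filter-∁ : {P : A → Set} (P? : Decidable P) (xs : List A) →
  length (filter P? xs) + length (filter (∁? P?) xs) ≡ length xs
length-filter+filter-∁ P? []       = refl
length-filter+filter-∁ P? (x ∷ xs) with does (P? x)
... | true  = cong suc (length-filter+filter-∁ P? xs)
... | false = trans (+-suc _ _) (cong suc (length-filter+filter-∁ P? xs))

filter-majority : {P : A → Set} (P? : Decidable P) (xs : List A) → suc (k + k) ≤ length xs →
  suc k ≤ length (filter P? xs) ⊎ suc k ≤ length (filter (∁? P?) xs)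
filter-majority {k = k} P? xs big with suc k ≤? length (filter P? xs)
... | yes many = inj₁ many
... | no few = inj₂ (+-cancelˡ-≤ k _ _ (≤-pred (begin
  suc (k + suc k)                                  ≡⟨ cong suc (+-suc k k) ⟩
  suc (suc (k + k))                                ≤⟨ s≤s big ⟩
  suc (length xs)                                  ≡⟨ cong suc (sym (length-filter+filter-∁ P? xs)) ⟩
  suc (length (filter P? xs) + length (filter (∁? P?) xs)) ≤⟨ s≤s (+-monoˡ-≤ _ (≤-pred (≰⇒> few))) ⟩
  suc (k + length (filter (∁? P?) xs))            ∎)))
  where open ≤-Reasoning

Monochromatic : (A → Fin k) → A × A → Set
Monochromatic col (a , b) = col a ≡ col b

record Matching (col : A → Fin k) (xs : List A) (j : ℕ) : Set where
  field
    pairs         : List (A × A)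
    rest          : List A
    length-pairs  : length pairs ≡ j
    monochromatic : All (Monochromatic col) pairs
    unique        : Unique (flat pairs ++ rest)
    ⊆xs           : flat pairs ++ rest ⊆ xs
    length-rest   : length xs ≤ 2 * j + length rest

module WithDecidableEquality {A : Set} (_≟_ : DecidableEquality A) where

  infixl 5 _without_
  _without_ : List A → A → List A
  xs without x = filter (λ y → ¬? (y ≟ x)) xs

  ∈-without⁻ : ∀ xs x {y} → y ∈ xs without x → y ∈ xs × y ≢ x
  ∈-without⁻ xs x = ∈-filter⁻ (λ y → ¬? (y ≟ x))

  Unique-without : ∀ {x xs} → Unique xs → Unique (xs without x)
  Unique-without = filter⁺ (λ y → ¬? (y ≟ _))

  length-without : ∀ x {xs} → Unique xs → length xs ≤ suc (length (xs without x))
  length-without x []                 = z≤n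
  length-without x {y ∷ xs} (y∉ ∷ u) = by-cases (y ≟ x)
    where
    by-cases : Dec (y ≡ x) → length (y ∷ xs) ≤ suc (length ((y ∷ xs) without x))
    by-cases (yes refl) = ≤-reflexive (cong (suc ∘ length) (sym (trans
      (filter-reject (λ z → ¬? (z ≟ x)) (λ x≢x → x≢x refl))
      (filter-all (λ z → ¬? (z ≟ x)) (All.map (λ y≢z z≡y → y≢z (sym z≡y)) y∉)))))
    by-cases (no y≢x) = ≤-trans (s≤s (length-without x u))
      (≤-reflexive (cong (suc ∘ length) (sym (filter-accept (λ z → ¬? (z ≟ x)) y≢x))))

  ∈-without₂⁻ : ∀ xs x y {z} → z ∈ xs without x without y → z ∈ xs × z ≢ x × z ≢ y
  ∈-without₂⁻ xs x y m with m′ , z≢y ← ∈-without⁻ (xs without x) y m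
                         with z∈ , z≢x ← ∈-without⁻ xs x m′ = z∈ , z≢x , z≢y

  length-without₂ : ∀ x y {xs} → Unique xs → length xs ≤ 2 + length (xs without x without y)
  length-without₂ x y u = ≤-trans (length-without x u) (s≤s (length-without y (Unique-without u)))

  -- Greedy: while more than k elements remain, pigeonhole yields a monochromatic pair.
  matching : (col : A → Fin k) (j : ℕ) {xs : List A} → Unique xs → 2 * j + k ≤ length xs →
    Matching col xs j
  matching col zero {xs} u _ = record
    { pairs = [] ; rest = xs ; length-pairs = refl ; monochromatic = [] ; unique = u
    ; ⊆xs = λ m → m ; length-rest = ≤-refl }
  matching {k} col (suc j) {xs} u big
    with a , b , a∈ , b∈ , a≢b , same ← sameColourPair col u (≤-trans (s≤s (m≤n+m k _)) big) =
    record
      { pairs = (a , b) ∷ pairs ; rest = rest ; length-pairs = cong suc length-pairs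
      ; monochromatic = same ∷ monochromatic
      ; unique = (a≢b ∷ All.tabulate (λ m → ≢a (⊆xs m))) ∷ All.tabulate (λ m → ≢b (⊆xs m)) ∷ unique
      ; ⊆xs = λ { (here refl) → a∈ ; (there (here refl)) → b∈ ; (there (there m)) → ⊆ys (⊆xs m) }
      ; length-rest = ≤-trans (length-without₂ a b u) (≤-trans (s≤s (s≤s length-rest))
                        (≤-reflexive (cong (_+ length rest) (sym (*-suc 2 j))))) }
    where
    ys = xs without a without b
    ⊆ys : ys ⊆ xs
    ⊆ys m = proj₁ (∈-without₂⁻ xs a b m)
    ≢a : ∀ {y} → y ∈ ys → a ≢ y
    ≢a m a≡y = proj₁ (proj₂ (∈-without₂⁻ xs a b m)) (sym a≡y)
    ≢b : ∀ {y} → y ∈ ys → b ≢ y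
    ≢b m b≡y = proj₂ (proj₂ (∈-without₂⁻ xs a b m)) (sym b≡y)
    room : 2 * j + k ≤ length ys
    room = ≤-pred (≤-pred (≤-trans (≤-reflexive (cong (_+ k) (sym (*-suc 2 j))))
             (≤-trans big (length-without₂ a b u))))
    open Matching (matching col j (Unique-without (Unique-without u)) room)

  -- Two of the first components of k + 1 monochromatic pairs share a colour; together
  -- with the partner of one of them this gives three elements of one colour.
  sameColourTriple : (col : A → Fin k) {xs : List A} → Unique xs → 2 * suc k + k ≤ length xs →
    ∃₂ λ a b → ∃ λ c → a ∈ xs × b ∈ xs × c ∈ xs × a ≢ b × a ≢ c × b ≢ c ×
                       col a ≡ col b × col a ≡ col c
  sameColourTriple {k} col {xs} u big = triple (matching col (suc k) u big)
    where
    triple : Matching col xs (suc k) →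
      ∃₂ λ a b → ∃ λ c → a ∈ xs × b ∈ xs × c ∈ xs × a ≢ b × a ≢ c × b ≢ c ×
                         col a ≡ col b × col a ≡ col c
    triple record { pairs = ps ; length-pairs = len ; monochromatic = mono ; unique = uni ; ⊆xs = ⊆xs }
      with uflat ← Unique-++⁻ˡ (flat ps) uni
      with a , a′ , a∈ , a′∈ , a≢a′ , same ← sameColourPair col (Unique-firsts ps uflat)
                                               (≤-reflexive (sym (trans (length-map proj₁ ps) len)))
      with (_ , b) , ab∈ , refl ← ∈-map⁻ proj₁ a∈
      with b∉firsts , _ ← partner-∉ uflat ab∈ =
      a , b , a′ , in-xs (firsts⊆flat ps a∈) , in-xs (proj₂ (∈-flat⁺ ab∈)) ,
      in-xs (firsts⊆flat ps a′∈) , (λ { refl → b∉firsts a∈ }) , a≢a′ ,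
      (λ { refl → b∉firsts a′∈ }) , All.lookup mono ab∈ , same
      where
      in-xs : ∀ {x} → x ∈ flat ps → x ∈ xs
      in-xs m = ⊆xs (∈-++⁺ˡ m)

  record DoubleMatching (c₁ c₂ : A → Fin k) (j : ℕ) (xs : List A) : Set where
    field
      pairs          : List (A × A)
      unique         : Unique (flat pairs)
      ⊆xs            : flat pairs ⊆ xs
      pairs₁ pairs₂  : List (A × A)
      length₁        : length pairs₁ ≡ j
      length₂        : length pairs₂ ≡ j
      unique₁        : Unique (flat pairs₁)
      unique₂        : Unique (flat pairs₂)
      monochromatic₁ : All (Monochromatic c₁) pairs₁
      monochromatic₂ : All (Monochromatic c₂) pairs₂
      ⊆pairs₁        : pairs₁ ⊆ pairs
      ⊆pairs₂        : pairs₂ ⊆ pairs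

  -- Few colours: pairs monochromatic for the product colouring serve both colourings.
  doubleMatchingByProduct : (c₁ c₂ : A → Fin k) (j : ℕ) {xs : List A} → Unique xs →
    2 * j + k * k ≤ length xs → DoubleMatching c₁ c₂ j xs
  doubleMatchingByProduct c₁ c₂ j u big = record
    { pairs = pairs ; unique = unique′ ; ⊆xs = λ m → ⊆xs (∈-++⁺ˡ m)
    ; pairs₁ = pairs ; pairs₂ = pairs ; length₁ = length-pairs ; length₂ = length-pairs
    ; unique₁ = unique′ ; unique₂ = unique′
    ; monochromatic₁ = All.map (λ {p} same → proj₁ (split p same)) monochromatic
    ; monochromatic₂ = All.map (λ {p} same → proj₂ (split p same)) monochromatic
    ; ⊆pairs₁ = λ m → m ; ⊆pairs₂ = λ m → m }
    where
    open Matching (matching (λ x → combine (c₁ x) (c₂ x)) j u big)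
    unique′ = Unique-++⁻ˡ (flat pairs) unique
    split : ∀ ((a , b) : A × A) → combine (c₁ a) (c₂ a) ≡ combine (c₁ b) (c₂ b) →
      c₁ a ≡ c₁ b × c₂ a ≡ c₂ b
    split (a , b) = combine-injective (c₁ a) (c₂ a) (c₁ b) (c₂ b)

  -- Many colours: take the pairs for c₂ among the elements left over by those for c₁.
  doubleMatchingByRounds : (c₁ c₂ : A → Fin k) (j : ℕ) {xs : List A} → Unique xs →
    2 * j + (2 * j + k) ≤ length xs → DoubleMatching c₁ c₂ j xs
  doubleMatchingByRounds {k} c₁ c₂ j {xs} u big = record
    { pairs = M₁.pairs ++ M₂.pairs
    ; unique = subst Unique (sym (flat-++ M₁.pairs M₂.pairs))
        (Unique-++-⊆ʳ (flat M₁.pairs) M₁.unique unique₂ (λ m → M₂.⊆xs (∈-++⁺ˡ m)))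
    ; ⊆xs = λ m → ⊆xs′ (subst (_ ∈_) (flat-++ M₁.pairs M₂.pairs) m)
    ; pairs₁ = M₁.pairs ; pairs₂ = M₂.pairs ; length₁ = M₁.length-pairs ; length₂ = M₂.length-pairs
    ; unique₁ = Unique-++⁻ˡ (flat M₁.pairs) M₁.unique ; unique₂ = unique₂
    ; monochromatic₁ = M₁.monochromatic ; monochromatic₂ = M₂.monochromatic
    ; ⊆pairs₁ = ∈-++⁺ˡ ; ⊆pairs₂ = ∈-++⁺ʳ M₁.pairs }
    where
    module M₁ = Matching (matching c₁ j u (≤-trans (m≤n+m _ (2 * j)) big))
    room : 2 * j + k ≤ length M₁.rest
    room = +-cancelˡ-≤ (2 * j) _ _ (≤-trans big M₁.length-rest)
    module M₂ = Matching (matching c₂ j (Unique-++⁻ʳ (flat M₁.pairs) M₁.unique) room)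
    unique₂ = Unique-++⁻ˡ (flat M₂.pairs) M₂.unique
    ⊆xs′ : flat M₁.pairs ++ flat M₂.pairs ⊆ xs
    ⊆xs′ m with ∈-++⁻ (flat M₁.pairs) m
    ... | inj₁ m₁ = M₁.⊆xs (∈-++⁺ˡ m₁)
    ... | inj₂ m₂ = M₁.⊆xs (∈-++⁺ʳ (flat M₁.pairs) (M₂.⊆xs (∈-++⁺ˡ m₂)))

  -- For k ≤ 2 the product colouring needs 2(k + 2) + k² ≤ 8k − 1 elements, for k ≥ 3 two rounds
  -- need 5k + 8 ≤ 8k − 1.
  doubleMatching : (c₁ c₂ : A → Fin k) {xs : List A} → Unique xs → 0 < k →
    suc (8 * k) ≤ 2 + length xs → DoubleMatching c₁ c₂ (2 + k) xs
  doubleMatching c₁ c₂ u (s≤s {n = 0} _) big =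
    doubleMatchingByProduct c₁ c₂ 3 u (≤-pred (≤-pred big))
  doubleMatching c₁ c₂ u (s≤s {n = 1} _) big =
    doubleMatchingByProduct c₁ c₂ 4 u (≤-trans (m≤m+n 12 3) (≤-pred (≤-pred big)))
  doubleMatching c₁ c₂ u (s≤s {n = suc (suc m)} _) big =
    doubleMatchingByRounds c₁ c₂ (5 + m) u
      (≤-pred (≤-pred (≤-trans (≤-trans (m≤m+n _ (3 * m)) (≤-reflexive (identity m))) big)))
    where
    identity : ∀ m → 2 + (2 * (5 + m) + (2 * (5 + m) + (3 + m)) + 3 * m) ≡ suc (8 * (3 + m))
    identity = solve-∀

¬¬-∀⊎∀ : {C : Set} {P Q : C → Set} → (∀ c₁ c₂ → P c₁ ⊎ Q c₂) →
  ¬ ¬ ((∀ c → ¬ ¬ P c) ⊎ (∀ c → ¬ ¬ Q c))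
¬¬-∀⊎∀ both ¬either = ¬either (inj₁ λ c₁ ¬P → ¬either (inj₂ λ c₂ ¬Q → [ ¬P , ¬Q ]′ (both c₁ c₂)))

elements : ∀ {m} → Subset m → List (Fin m)
elements []          = []
elements (true ∷ p)  = zero ∷ map suc (elements p)
elements (false ∷ p) = map suc (elements p)

length-elements : ∀ {m} (p : Subset m) → length (elements p) ≡ ∣ p ∣
length-elements []          = refl
length-elements (true ∷ p)  = cong suc (trans (length-map suc (elements p)) (length-elements p))
length-elements (false ∷ p) = trans (length-map suc (elements p)) (length-elements p)

∈-elements⁻ : ∀ {m} (p : Subset m) {x} → x ∈ elements p → x ∈ₛ p
∈-elements⁻ (true ∷ p)  (here refl) = here
∈-elements⁻ (true ∷ p)  (there m) with _ , m′ , refl ← ∈-map⁻ suc m = there (∈-elements⁻ p m′)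
∈-elements⁻ (false ∷ p) m         with _ , m′ , refl ← ∈-map⁻ suc m = there (∈-elements⁻ p m′)

Unique-elements : ∀ {m} (p : Subset m) → Unique (elements p)
Unique-elements []          = []
Unique-elements (true ∷ p)  =
  All.tabulate zero∉ ∷ map⁺ suc-injective (Unique-elements p)
  where
  zero∉ : ∀ {x} → x ∈ map suc (elements p) → zero ≢ x
  zero∉ m refl with _ , _ , () ← ∈-map⁻ suc m
Unique-elements (false ∷ p) = map⁺ suc-injective (Unique-elements p)

member : ∀ {m} (p : Subset m) → 0 < ∣ p ∣ → ∃ (_∈ₛ p)
member p 0<∣p∣ with elements p | ∈-elements⁻ p | length-elements p
... | x ∷ _ | ∈⁻ | _    = x , ∈⁻ (here refl)
... | []    | _  | 0≡∣p∣ with () ← subst (0 <_) (sym 0≡∣p∣) 0<∣p∣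

≢-either : ∀ {m} {v₁ v₂ : Fin m} → v₁ ≢ v₂ → ∀ z → v₁ ≢ z ⊎ v₂ ≢ z
≢-either {v₁ = v₁} v₁≢v₂ z with v₁ ≟ z
... | no v₁≢z  = inj₁ v₁≢z
... | yes refl = inj₂ (≢-sym v₁≢v₂)

module GraphLemmas (G : Graph) where

  V : Set
  V = Fin (n G)

  adj-trace : ∀ {v} {X Y : Subset (n G)} → N G v ∩ X ≡ Y → ∀ {t} → t ∈ₛ X → adj G v t ≡ Vec.lookup Y t
  adj-trace {v} {X} {Y} eq {t} t∈X = begin
    adj G v t                     ≡⟨ sym (∧-identityʳ _) ⟩
    adj G v t ∧ true              ≡⟨ cong₂ _∧_ (sym (lookup∘tabulate (adj G v) t)) (sym ([]=⇒lookup t∈X)) ⟩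
    Vec.lookup (N G v) t ∧ Vec.lookup X t ≡⟨ sym (lookup-zipWith _∧_ t (N G v) X) ⟩
    Vec.lookup (N G v ∩ X) t          ≡⟨ cong (λ Z → Vec.lookup Z t) eq ⟩
    Vec.lookup Y t                    ∎
    where open ≡-Reasoning

  adj-inside : ∀ {v} {X Y : Subset (n G)} → N G v ∩ X ≡ Y → ∀ {t} → t ∈ₛ X → t ∈ₛ Y →
    adj G v t ≡ true
  adj-inside eq t∈X t∈Y = trans (adj-trace eq t∈X) ([]=⇒lookup t∈Y)

  adj-outside : ∀ {v} {X Y : Subset (n G)} → N G v ∩ X ≡ Y → ∀ {t} → t ∈ₛ X → ¬ t ∈ₛ Y →
    adj G v t ≡ false
  adj-outside eq t∈X t∉Y = trans (adj-trace eq t∈X) (¬-not (t∉Y ∘ lookup⇒[]= _ _))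

  adj⇒≢ : ∀ {u v} → adj G u v ≡ true → u ≢ v
  adj⇒≢ {u} uv refl with () ← trans (sym uv) (loopless G u)

  flipAdj-≢ : ∀ {k} (F : KFlip G k) {u v} → u ≢ v →
    flipAdj G F u v ≡ adj G u v xor fl F (col F u) (col F v)
  flipAdj-≢ F {u} {v} u≢v with u ≟ v
  ... | yes u≡v = ⊥-elim (u≢v u≡v)
  ... | no _    = refl

  flipAdj-kept : ∀ {k} (F : KFlip G k) {u v} → adj G u v ≡ true → fl F (col F u) (col F v) ≡ false →
    flipAdj G F u v ≡ true
  flipAdj-kept F uv f = trans (flipAdj-≢ F (adj⇒≢ uv)) (cong₂ _xor_ uv f)

  flipAdj-created : ∀ {k} (F : KFlip G k) {u v} → u ≢ v → adj G u v ≡ false →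
    fl F (col F u) (col F v) ≡ true → flipAdj G F u v ≡ true
  flipAdj-created F u≢v uv f = trans (flipAdj-≢ F u≢v) (cong₂ _xor_ uv f)

  flipNeighbour : ∀ {k} (F : KFlip G k) {z z′ v} → col F z ≡ col F z′ →
    adj G v z ≡ true → adj G v z′ ≡ false → v ≢ z′ →
    flipAdj G F z v ≡ true ⊎ flipAdj G F z′ v ≡ true
  flipNeighbour F {z} {z′} {v} same vz vz′ v≢z′ = by-cases _ refl
    where
    by-cases : ∀ b → fl F (col F z) (col F v) ≡ b → flipAdj G F z v ≡ true ⊎ flipAdj G F z′ v ≡ true
    by-cases false f = inj₁ (flipAdj-kept F (trans (adj-sym G z v) vz) f)
    by-cases true  f = inj₂ (flipAdj-created F (≢-sym v≢z′) (trans (adj-sym G z′ v) vz′)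
                               (trans (cong (λ c → fl F c (col F v)) (sym same)) f))

walk? : ∀ {m} (H : Fin m → Fin m → Bool) r u w → Dec (Walk H r u w)
walk? H zero u w = Dec.map′ (λ { refl → stay }) (λ { stay → refl }) (u ≟ w)
walk? H (suc r) u w =
  Dec.map′ (λ { (inj₁ refl) → stay ; (inj₂ (v , uv , vw)) → step uv vw })
           (λ { stay → inj₁ refl ; (step uv vw) → inj₂ (_ , uv , vw) })
           ((u ≟ w) ⊎-dec any? (λ v → (H u v ≟ᵇ true) ×-dec walk? H r v w))

neighbour⇒¬isolated : ∀ {m} {H : Fin m → Fin m → Bool} {w u} → H w u ≡ true → ¬ Isolated H w
neighbour⇒¬isolated wu isolated with () ← trans (sym wu) (isolated _)

walk⇒neighbour : ∀ {m} {H : Fin m → Fin m → Bool} {r u w} → Walk H r u w → u ≢ w → ∃ λ v → H u v ≡ true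
walk⇒neighbour stay        u≢u = ⊥-elim (u≢u refl)
walk⇒neighbour (step uv _) _   = _ , uv

-- Escaping is only required up to double negation: the conclusion is negative, and the
-- radius-1 invariant quantifies over all future colourings.
module _ {G : Graph} {r k : ℕ} (Safe : (Fin (n G) → Fin (n G) → Bool) → Fin (n G) → Set)
  (escape : ∀ {H v} → Safe H v → (F : KFlip G k) →
              ¬ ¬ (∃ λ w → Walk H r v w × Safe (flipAdj G F) w))
  (safe⇒nonIsolated : ∀ (F : KFlip G k) {w} → Safe (flipAdj G F) w → ¬ Isolated (flipAdj G F) w)
  where

  runnerSurvives : ∀ {H v} → Safe H v → ¬ FlipperWinsFrom G r k H v
  runnerSurvives safe (announce F win) = escape safe F (λ (w , walk , safe′) → survive (win w walk) safe′)
    where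
    survive : ∀ {w} → Isolated (flipAdj G F) w ⊎ FlipperWinsFrom G r k (flipAdj G F) w →
      Safe (flipAdj G F) w → ⊥
    survive (inj₁ isolated) safe′ = safe⇒nonIsolated F safe′ isolated
    survive (inj₂ wins)     safe′ = runnerSurvives safe′ wins

  flipperLoses : ∀ {v₀} → Safe (adj G) v₀ → ¬ FlipperWins r k G
  flipperLoses safe wins = runnerSurvives safe (wins _)

noVertices : ∀ {G r} → FlipperWins r 0 G → ¬ Fin (n G)
noVertices wins v with announce F _ ← wins v with () ← col F v

module Crowds (G : Graph) (X : Subset (n G)) (k : ℕ) where
  open GraphLemmas G

  record Crowd (P : V → Set) : Set where
    field
      members  : List V
      many     : suc k ≤ length members
      unique   : Unique members
      inX      : All (_∈ₛ X) members
      property : All P members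

  crowd-avoiding : ∀ {P} → 0 < k → Crowd P → ∀ y → ∃ λ t → t ≢ y × P t
  crowd-avoiding k>0 record { many = many ; unique = u ; property = P-members } y
    with a , b , a∈ , b∈ , a≢b ← distinctPair u (≤-trans (s≤s k>0) many) | a ≟ y
  ... | no a≢y   = a , a≢y , All.lookup P-members a∈
  ... | yes refl = b , ≢-sym a≢b , All.lookup P-members b∈

xor-transfer : ∀ x y f → x xor f ≡ false → x xor y ≡ true → y xor f ≡ true
xor-transfer false true  false _  _  = refl
xor-transfer true  false true  _  _  = refl
xor-transfer false false _     _  ()
xor-transfer true  true  _     _  ()
xor-transfer false true  true  () _
xor-transfer true  false false () _

module VCdimension (G : Graph) (X : Subset (n G)) (k : ℕ) where
  open GraphLemmas G
  open Crowds G X k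
  open WithDecidableEquality (_≟_ {n G})
  open import Data.List.Membership.DecPropositional (_≟_ {n G}) using (_∈?_)

  Separates : V → V × V → Set
  Separates v (a , b) = adj G v a xor adj G v b ≡ true

  record Splitting (c : V → Fin k) (v : V) : Set where
    field
      pairs         : List (V × V)
      many          : 2 + k ≤ length pairs
      unique        : Unique (flat pairs)
      inX           : All (_∈ₛ X) (flat pairs)
      monochromatic : All (Monochromatic c) pairs
      separated     : All (Separates v) pairs

  -- In the flipped graph v is still adjacent to exactly one vertex of each pair, as both
  -- lie in the same part; choosing it and discarding v itself leaves k + 1 neighbours.
  splitting⇒crowd : (F : KFlip G k) {v : V} → Splitting (col F) v →
    Crowd (λ t → flipAdj G F v t ≡ true)
  splitting⇒crowd F {v} s = record
    { members  = map pick pairs without v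
    ; many     = ≤-pred (≤-trans many (≤-trans (≤-reflexive (sym (length-map pick pairs)))
                   (length-without v (Unique-choice pick pick∈ pairs unique))))
    ; unique   = Unique-without (Unique-choice pick pick∈ pairs unique)
    ; inX      = All.tabulate λ m → All.lookup inX (choice⊆flat pick pick∈ pairs (proj₁ (∈-without⁻ _ v m)))
    ; property = All.tabulate λ m → let m′ , t≢v = ∈-without⁻ _ v m in
        trans (flipAdj-≢ F (≢-sym t≢v)) (flipped-chosen m′) }
    where
    open Splitting s
    flipped : V → Bool
    flipped t = adj G v t xor fl F (col F v) (col F t)
    pick : V × V → V
    pick (a , b) = if flipped a then a else b
    pick∈ : ∀ p → pick p ≡ proj₁ p ⊎ pick p ≡ proj₂ p
    pick∈ (a , b) with flipped a
    ... | true  = inj₁ refl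
    ... | false = inj₂ refl
    flipped-pick : ∀ {p} → p ∈ pairs → flipped (pick p) ≡ true
    flipped-pick {a , b} p∈ with flipped a in fa
    ... | true  = fa
    ... | false = subst (λ c → adj G v b xor fl F (col F v) c ≡ true) (All.lookup monochromatic p∈)
                    (xor-transfer (adj G v a) (adj G v b) _ fa (All.lookup separated p∈))
    flipped-chosen : ∀ {t} → t ∈ map pick pairs → flipped t ≡ true
    flipped-chosen m with p , p∈ , refl ← ∈-map⁻ pick m = flipped-pick p∈

  separates : ∀ {v a b} → adj G v a ≡ true → adj G v b ≡ false → Separates v (a , b)
  separates va vb rewrite va | vb = refl

  separates′ : ∀ {v a b} → adj G v a ≡ false → adj G v b ≡ true → Separates v (a , b)
  separates′ va vb rewrite va | vb = refl

  Splitter : (z z′ : V) (c₁ c₂ : V → Fin k) → V → Set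
  Splitter z z′ c₁ c₂ v = adj G v z ≡ true × adj G v z′ ≡ false × Splitting c₁ v × Splitting c₂ v

  SplitterNear : (V → V → Bool) → V → (V → Fin k) → Set
  SplitterNear H x c = ∃ λ v → H x v ≡ true × Splitting c v

  splitterStaysNear : (F : KFlip G k) {z z′ v : V} {c₁ c₂ : V → Fin k} → col F z ≡ col F z′ → v ≢ z′ →
    Splitter z z′ c₁ c₂ v → SplitterNear (flipAdj G F) z c₁ ⊎ SplitterNear (flipAdj G F) z′ c₂
  splitterStaysNear F same v≢z′ (vz , vz′ , s₁ , s₂) =
    Sum.map (λ e → _ , e , s₁) (λ e → _ , e , s₂) (flipNeighbour F same vz vz′ v≢z′)

  vertexWithTrace : Shattered G X → ∀ {z} (S : List V) → z ∈ₛ X → All (_∈ₛ X) S →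
    ∃ λ v → (∀ {t} → t ∈ₛ X → t ≡ z ⊎ t ∈ S → adj G v t ≡ true) ×
            (∀ {t} → t ∈ₛ X → t ≢ z → t ∉ S → adj G v t ≡ false)
  vertexWithTrace shattered {z} S z∈X S⊆X =
    let v , trace = shattered Y Y⊆X in
    v , (λ t∈X t∈ → trans (adj-trace trace t∈X) (trans (lookup∘tabulate χ _) (χ-true t∈))) ,
        (λ t∈X t≢z t∉ → trans (adj-trace trace t∈X) (trans (lookup∘tabulate χ _) (χ-false t≢z t∉)))
    where
    χ : V → Bool
    χ t = does (t ≟ z) ∨ does (t ∈? S)
    Y = tabulate χ
    χ-true : ∀ {t} → t ≡ z ⊎ t ∈ S → χ t ≡ true
    χ-true {t} (inj₁ refl) rewrite dec-true (t ≟ t) refl = refl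
    χ-true {t} (inj₂ t∈)   rewrite dec-true (t ∈? S) t∈ = ∨-zeroʳ _
    χ-false : ∀ {t} → t ≢ z → t ∉ S → χ t ≡ false
    χ-false {t} t≢z t∉ rewrite dec-false (t ≟ z) t≢z | dec-false (t ∈? S) t∉ = refl
    Y⊆X : Y ⊆ₛ X
    Y⊆X {t} t∈Y with t ≟ z | t ∈? S | trans (sym (lookup∘tabulate χ t)) ([]=⇒lookup t∈Y)
    ... | yes refl | _      | _ = z∈X
    ... | no _     | yes t∈ | _ = All.lookup S⊆X t∈
    ... | no _     | no _   | ()

  module Runner (shattered : Shattered G X) (k>0 : 0 < k) (big : suc (8 * k) ≤ ∣ X ∣) where

    twoSplitters : ∀ {z z′} → z ∈ₛ X → z′ ∈ₛ X → z ≢ z′ →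
      (c₁ c₂ : V → Fin k) → ∃₂ λ v₁ v₂ → v₁ ≢ v₂ × Splitter z z′ c₁ c₂ v₁ × Splitter z z′ c₁ c₂ v₂
    twoSplitters {z} {z′} z∈X z′∈X z≢z′ c₁ c₂ =
      let v₁ , in₁ , out₁ = vertexWithTrace shattered firsts z∈X (S⊆X (firsts⊆flat pairs))
          v₂ , in₂ , out₂ = vertexWithTrace shattered seconds z∈X (S⊆X (seconds⊆flat pairs))
      in v₁ , v₂ , distinct in₁ out₂ ,
         splitter (firsts⊆flat pairs) in₁ out₁ (separated-by-firsts in₁ out₁) ,
         splitter (seconds⊆flat pairs) in₂ out₂ (separated-by-seconds in₂ out₂)
      where
      xs = elements X without z without z′
      room : suc (8 * k) ≤ 2 + length xs
      room = ≤-trans big (≤-trans (≤-reflexive (sym (length-elements X)))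
               (length-without₂ z z′ (Unique-elements X)))
      open DoubleMatching
        (doubleMatching c₁ c₂ (Unique-without (Unique-without (Unique-elements X))) k>0 room)
      In Out : V → List V → Set
      In v S = ∀ {t} → t ∈ₛ X → t ≡ z ⊎ t ∈ S → adj G v t ≡ true
      Out v S = ∀ {t} → t ∈ₛ X → t ≢ z → t ∉ S → adj G v t ≡ false
      firsts = map proj₁ pairs
      seconds = map proj₂ pairs
      in-xs : ∀ {t} → t ∈ flat pairs → t ∈ elements X × t ≢ z × t ≢ z′
      in-xs m = ∈-without₂⁻ (elements X) z z′ (⊆xs m)
      inX : ∀ {t} → t ∈ flat pairs → t ∈ₛ X
      inX m = ∈-elements⁻ X (proj₁ (in-xs m))
      ≢z : ∀ {t} → t ∈ flat pairs → t ≢ z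
      ≢z m = proj₁ (proj₂ (in-xs m))
      S⊆X : ∀ {S} → S ⊆ flat pairs → All (_∈ₛ X) S
      S⊆X S⊆ = All.tabulate (inX ∘ S⊆)
      nonempty : ∀ (ps : List (V × V)) → length ps ≡ 2 + k → ∃ (_∈ ps)
      nonempty (p ∷ _) _ = p , here refl
      separated-by-firsts : ∀ {v} → In v firsts → Out v firsts → ∀ {p} → p ∈ pairs → Separates v p
      separated-by-firsts in′ out′ ab∈ with a∈ , b∈ ← ∈-flat⁺ ab∈ =
        separates (in′ (inX a∈) (inj₂ (∈-map⁺ proj₁ ab∈)))
                  (out′ (inX b∈) (≢z b∈) (proj₁ (partner-∉ unique ab∈)))
      separated-by-seconds : ∀ {v} → In v seconds → Out v seconds → ∀ {p} → p ∈ pairs → Separates v p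
      separated-by-seconds in′ out′ ab∈ with a∈ , b∈ ← ∈-flat⁺ ab∈ =
        separates′ (out′ (inX a∈) (≢z a∈) (proj₂ (partner-∉ unique ab∈)))
                   (in′ (inX b∈) (inj₂ (∈-map⁺ proj₂ ab∈)))
      distinct : ∀ {v₁ v₂} → In v₁ firsts → Out v₂ seconds → v₁ ≢ v₂
      distinct in₁ out₂ refl with _ , ab∈ ← nonempty pairs₁ length₁ with a∈ , _ ← ∈-flat⁺ (⊆pairs₁ ab∈)
        with () ← trans (sym (in₁ (inX a∈) (inj₂ (∈-map⁺ proj₁ (⊆pairs₁ ab∈)))))
                        (out₂ (inX a∈) (≢z a∈) (proj₂ (partner-∉ unique (⊆pairs₁ ab∈))))
      splitter : ∀ {S v} → S ⊆ flat pairs → In v S → Out v S →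
        (∀ {p} → p ∈ pairs → Separates v p) → Splitter z z′ c₁ c₂ v
      splitter S⊆ in′ out′ sep =
        in′ z∈X (inj₁ refl) ,
        out′ z′∈X (≢-sym z≢z′) (λ m → proj₂ (proj₂ (in-xs (S⊆ m))) refl) ,
        splitting pairs₁ length₁ unique₁ ⊆pairs₁ monochromatic₁ ,
        splitting pairs₂ length₂ unique₂ ⊆pairs₂ monochromatic₂
        where
        splitting : ∀ {c} ps → length ps ≡ 2 + k → Unique (flat ps) → ps ⊆ pairs →
          All (Monochromatic c) ps → Splitting c _
        splitting ps len u ps⊆ mono = record
          { pairs = ps ; many = ≤-reflexive (sym len) ; unique = u
          ; inX = All.tabulate (inX ∘ flat-⊆ ps⊆) ; monochromatic = mono
          ; separated = All.tabulate (sep ∘ ps⊆) }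

    splitterNextTo : (F : KFlip G k) {z z′ : V} → z ∈ₛ X → z′ ∈ₛ X → z ≢ z′ → col F z ≡ col F z′ →
      (c₁ c₂ : V → Fin k) → SplitterNear (flipAdj G F) z c₁ ⊎ SplitterNear (flipAdj G F) z′ c₂
    splitterNextTo F z∈X z′∈X z≢z′ same c₁ c₂ =
      let v₁ , v₂ , v₁≢v₂ , s₁ , s₂ = twoSplitters z∈X z′∈X z≢z′ c₁ c₂ in
      [ (λ v₁≢z′ → splitterStaysNear F same v₁≢z′ s₁) , (λ v₂≢z′ → splitterStaysNear F same v₂≢z′ s₂) ]′
        (≢-either v₁≢v₂ _)

    Safe : (V → V → Bool) → V → Set
    Safe H x = (∀ c → ¬ ¬ SplitterNear H x c) ⊎ Crowd (λ t → H x t ≡ true)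

    escape : ∀ {H x} → Safe H x → (F : KFlip G k) →
      ¬ ¬ (∃ λ w → Walk H 1 x w × Safe (flipAdj G F) w)
    escape (inj₁ near) F κ =
      near (col F) λ (v , xv , s) → κ (v , step xv stay , inj₂ (splitting⇒crowd F s))
    escape (inj₂ record { unique = u ; many = many ; inX = inX ; property = adjacent }) F κ
      with z , z′ , z∈ , z′∈ , z≢z′ , same ← sameColourPair (col F) u many =
      ¬¬-∀⊎∀ (splitterNextTo F (All.lookup inX z∈) (All.lookup inX z′∈) z≢z′ same)
        λ { (inj₁ near) → κ (z  , step (All.lookup adjacent z∈) stay , inj₁ near)
          ; (inj₂ near) → κ (z′ , step (All.lookup adjacent z′∈) stay , inj₁ near) }

    safe⇒¬isolated : ∀ (F : KFlip G k) {w} → Safe (flipAdj G F) w → ¬ Isolated (flipAdj G F) w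
    safe⇒¬isolated F (inj₁ near) isolated =
      near (col F) λ (_ , wv , _) → neighbour⇒¬isolated {H = flipAdj G F} wv isolated
    safe⇒¬isolated F {w} (inj₂ crowd) =
      neighbour⇒¬isolated {H = flipAdj G F} (proj₂ (proj₂ (crowd-avoiding k>0 crowd w)))

    two≤∣X∣ : 2 ≤ length (elements X)
    two≤∣X∣ = ≤-trans (s≤s (≤-trans k>0 (m≤n*m k 8))) (≤-trans big (≤-reflexive (sym (length-elements X))))

    safeStart : ∃ λ z → Safe (adj G) z
    safeStart with z , z′ , z∈ , z′∈ , z≢z′ ← distinctPair (Unique-elements X) two≤∣X∣ =
      z , inj₁ λ c κ →
        let v , _ , _ , (vz , _ , s , _) , _ = twoSplitters (∈-elements⁻ X z∈) (∈-elements⁻ X z′∈) z≢z′ c c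
        in κ (v , trans (adj-sym G z v) vz , s)

  bound : Shattered G X → 0 < k → FlipperWins 1 k G → ∣ X ∣ ≤ 8 * k
  bound shattered k>0 wins with ∣ X ∣ ≤? 8 * k
  ... | yes small = small
  ... | no ¬small = ⊥-elim (flipperLoses Safe escape safe⇒¬isolated (proj₂ safeStart) wins)
    where open Runner shattered k>0 (≰⇒> ¬small)

reachedBound : ∀ {k r w} → 0 < k → suc (8 * k) ≤ r + w → w < 2 * suc k + k → suc (k + k) ≤ r
reachedBound {suc m} {r} {w} _ room few = +-cancelʳ-≤ (2 * suc (suc m) + suc m) _ _ (begin
  suc (suc m + suc m) + (2 * suc (suc m) + suc m)       ≤⟨ m≤m+n _ (2 + 3 * m) ⟩
  suc (suc m + suc m) + (2 * suc (suc m) + suc m) + (2 + 3 * m) ≡⟨ identity m ⟩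
  suc (suc (8 * suc m))                                ≤⟨ s≤s room ⟩
  suc (r + w)                                          ≡⟨ sym (+-suc r w) ⟩
  r + suc w                                            ≤⟨ +-monoʳ-≤ r few ⟩
  r + (2 * suc (suc m) + suc m)                        ∎)
  where
  open ≤-Reasoning
  identity : ∀ m → suc (suc m + suc m) + (2 * suc (suc m) + suc m) + (2 + 3 * m) ≡ suc (suc (8 * suc m))
  identity = solve-∀

module TwoVCdimension (G : Graph) (X : Subset (n G)) (k : ℕ) where
  open GraphLemmas G
  open Crowds G X k
  open WithDecidableEquality (_≟_ {n G})

  module Runner (twoShattered : TwoShattered G X) (k>0 : 0 < k) (big : 3 + 8 * k ≤ ∣ X ∣) where

    PairWitness : V → V → V → Set
    PairWitness a b w = adj G w a ≡ true × adj G w b ≡ true ×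
                        (∀ {t} → t ∈ₛ X → t ≢ a → t ≢ b → adj G w t ≡ false)

    pairWitness : ∀ {a b} → a ∈ₛ X → b ∈ₛ X → a ≢ b → ∃ (PairWitness a b)
    pairWitness {a} {b} a∈X b∈X a≢b =
      let w , trace = twoShattered a b a∈X b∈X a≢b in
      w , adj-inside trace a∈X (x∈p∪q⁺ (inj₁ (x∈⁅x⁆ a))) , adj-inside trace b∈X (x∈p∪q⁺ (inj₂ (x∈⁅x⁆ b))) ,
      λ t∈X t≢a t≢b → adj-outside trace t∈X
        λ t∈ → [ t≢a ∘ x∈⁅y⁆⇒x≡y a , t≢b ∘ x∈⁅y⁆⇒x≡y b ]′ (x∈p∪q⁻ ⁅ a ⁆ ⁅ b ⁆ t∈)

    module AfterFlip (F : KFlip G k) {u u′ : V} (u∈X : u ∈ₛ X) (u′∈X : u′ ∈ₛ X) (u≢u′ : u ≢ u′)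
                     (same : col F u ≡ col F u′) where

      Reached : V → Set
      Reached t = Walk (flipAdj G F) 2 u t ⊎ Walk (flipAdj G F) 2 u′ t

      Outside : V → Set
      Outside v = v ∈ₛ X × v ≢ u × v ≢ u′

      -- After the flip w is adjacent to u or u′; it stays adjacent to v unless the parts of w
      -- and v are flipped, and then it becomes adjacent to the rest of X in the part of v.
      reachedViaWitness : ∀ {v w} → Outside v → PairWitness u v w → w ≢ u′ →
        Reached v ⊎ (∀ {t} → Outside t → t ≢ v → t ≢ w → col F t ≡ col F v → Reached t)
      reachedViaWitness {v} {w} (_ , v≢u , v≢u′) (wu , wv , w-others) w≢u′ = by-cases _ refl
        where
        via : ∀ {t} → flipAdj G F w t ≡ true → Reached t
        via wt = Sum.map (λ uw → step uw (step wt stay)) (λ u′w → step u′w (step wt stay))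
                         (flipNeighbour F same wu (w-others u′∈X (≢-sym u≢u′) (≢-sym v≢u′)) w≢u′)
        by-cases : ∀ b → fl F (col F w) (col F v) ≡ b →
          Reached v ⊎ (∀ {t} → Outside t → t ≢ v → t ≢ w → col F t ≡ col F v → Reached t)
        by-cases false f = inj₁ (via (flipAdj-kept F wv f))
        by-cases true  f = inj₂ λ (t∈X , t≢u , _) t≢v t≢w same-t →
          via (flipAdj-created F (≢-sym t≢w) (w-others t∈X t≢u t≢v)
                 (trans (cong (fl F (col F w)) same-t) f))

      unreachedTriple : ∀ {v a b w} → Outside v → Outside a → Outside b → a ≢ v → b ≢ v → a ≢ b →
        col F a ≡ col F v → col F b ≡ col F v → PairWitness u v w → w ≢ u′ →
        ¬ Reached v → ¬ Reached a → ¬ Reached b → ⊥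
      unreachedTriple {a = a} {w = w} out-v out-a out-b a≢v b≢v a≢b a~v b~v witness w≢u′ ¬v ¬a ¬b
        with reachedViaWitness out-v witness w≢u′ | a ≟ w
      ... | inj₁ reached-v | _        = ¬v reached-v
      ... | inj₂ others    | no a≢w   = ¬a (others out-a a≢v a≢w a~v)
      ... | inj₂ others    | yes refl = ¬b (others out-b b≢v (≢-sym a≢b) b~v)

      -- The witnesses of {u, v₁} and {u, v₂} differ, so one of them is not u′.
      noUnreachedTriple : ∀ {v₁ v₂ v₃} → Outside v₁ → Outside v₂ → Outside v₃ →
        v₁ ≢ v₂ → v₁ ≢ v₃ → v₂ ≢ v₃ → col F v₁ ≡ col F v₂ → col F v₁ ≡ col F v₃ →
        ¬ Reached v₁ → ¬ Reached v₂ → ¬ Reached v₃ → ⊥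
      noUnreachedTriple out₁@(v₁∈X , v₁≢u , _) out₂@(v₂∈X , v₂≢u , _) out₃
                        v₁≢v₂ v₁≢v₃ v₂≢v₃ 1~2 1~3 ¬1 ¬2 ¬3
        with pairWitness u∈X v₁∈X (≢-sym v₁≢u)
           | pairWitness u∈X v₂∈X (≢-sym v₂≢u)
      ... | w₁ , W₁@(_ , w₁v₁ , _) | w₂ , W₂@(_ , _ , w₂-others) with w₁ ≟ u′
      ... | no w₁≢u′ =
        unreachedTriple out₁ out₂ out₃ (≢-sym v₁≢v₂) (≢-sym v₁≢v₃) v₂≢v₃
          (sym 1~2) (sym 1~3) W₁ w₁≢u′ ¬1 ¬2 ¬3
      ... | yes refl =
        unreachedTriple out₂ out₁ out₃ v₁≢v₂ (≢-sym v₂≢v₃) v₁≢v₃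
          1~2 (trans (sym 1~3) 1~2) W₂ w₂≢u′ ¬2 ¬1 ¬3
        where
        w₂≢u′ : w₂ ≢ u′
        w₂≢u′ refl with () ← trans (sym w₁v₁) (w₂-others v₁∈X v₁≢u v₁≢v₂)

      L : List V
      L = elements X without u without u′

      unique-L : Unique L
      unique-L = Unique-without (Unique-without (Unique-elements X))

      outside : ∀ {t} → t ∈ L → Outside t
      outside m = let t∈ , t≢u , t≢u′ = ∈-without₂⁻ (elements X) u u′ m in ∈-elements⁻ X t∈ , t≢u , t≢u′

      reached? : ∀ t → Dec (Reached t)
      reached? t = walk? (flipAdj G F) 2 u t ⊎-dec walk? (flipAdj G F) 2 u′ t

      reached unreached : List V
      reached   = filter reached? L
      unreached = filter (∁? reached?) L

      ∈-reached : ∀ {t} → t ∈ reached → t ∈ L × Reached t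
      ∈-reached = ∈-filter⁻ reached? {xs = L}

      ∈-unreached : ∀ {t} → t ∈ unreached → t ∈ L × ¬ Reached t
      ∈-unreached = ∈-filter⁻ (∁? reached?) {xs = L}

      few-unreached : ¬ (2 * suc k + k ≤ length unreached)
      few-unreached many =
        let a , b , c , a∈ , b∈ , c∈ , a≢b , a≢c , b≢c , a~b , a~c =
              sameColourTriple (col F) (filter⁺ (∁? reached?) unique-L) many in
        noUnreachedTriple (outside (proj₁ (∈-unreached a∈))) (outside (proj₁ (∈-unreached b∈)))
          (outside (proj₁ (∈-unreached c∈))) a≢b a≢c b≢c a~b a~c
          (proj₂ (∈-unreached a∈)) (proj₂ (∈-unreached b∈)) (proj₂ (∈-unreached c∈))

      many-reached : suc (k + k) ≤ length reached
      many-reached = reachedBound k>0 (≤-pred (≤-pred (begin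
        3 + 8 * k                                ≤⟨ big ⟩
        ∣ X ∣                                     ≡⟨ sym (length-elements X) ⟩
        length (elements X)                      ≤⟨ length-without₂ u u′ (Unique-elements X) ⟩
        2 + length L                             ≡⟨ cong (2 +_) (sym (length-filter+filter-∁ reached? L)) ⟩
        2 + (length reached + length unreached)  ∎)))
        (≰⇒> few-unreached)
        where open ≤-Reasoning

      crowdNear : Crowd (Walk (flipAdj G F) 2 u) ⊎ Crowd (Walk (flipAdj G F) 2 u′)
      crowdNear = Sum.map (crowdAmongReached from-u? proj₂)
                          (crowdAmongReached (∁? from-u?) (λ (r , ¬from-u) → from-u′ r ¬from-u))
                          (filter-majority from-u? reached many-reached)
        where
        from-u? : ∀ t → Dec (Walk (flipAdj G F) 2 u t)
        from-u? = walk? (flipAdj G F) 2 u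
        from-u′ : ∀ {t} → Reached t → ¬ Walk (flipAdj G F) 2 u t → Walk (flipAdj G F) 2 u′ t
        from-u′ (inj₁ walk)  ¬walk = ⊥-elim (¬walk walk)
        from-u′ (inj₂ walk′) _     = walk′
        crowdAmongReached : ∀ {P Q : V → Set} (Q? : ∀ t → Dec (Q t)) → (∀ {t} → Reached t × Q t → P t) →
          suc k ≤ length (filter Q? reached) → Crowd P
        crowdAmongReached Q? P⇐ many = record
          { members = filter Q? reached ; many = many ; unique = filter⁺ Q? (filter⁺ reached? unique-L)
          ; inX = All.tabulate λ m → let m′ , _ = ∈-filter⁻ Q? {xs = reached} m in
              proj₁ (outside (proj₁ (∈-reached m′)))
          ; property = All.tabulate λ m → let m′ , q = ∈-filter⁻ Q? {xs = reached} m in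
              P⇐ (proj₂ (∈-reached m′) , q) }

    Safe : (V → V → Bool) → V → Set
    Safe H y = Crowd (Walk H 2 y)

    escape : ∀ {H y} → Safe H y → (F : KFlip G k) → ¬ ¬ (∃ λ w → Walk H 2 y w × Safe (flipAdj G F) w)
    escape record { many = many ; unique = uq ; inX = inX ; property = walks } F κ =
      let u , u′ , u∈ , u′∈ , u≢u′ , same = sameColourPair (col F) uq many in
      κ ([ (λ crowd → u , All.lookup walks u∈ , crowd) , (λ crowd → u′ , All.lookup walks u′∈ , crowd) ]′
           (AfterFlip.crowdNear F (All.lookup inX u∈) (All.lookup inX u′∈) u≢u′ same))

    safe⇒¬isolated : ∀ (F : KFlip G k) {w} → Safe (flipAdj G F) w → ¬ Isolated (flipAdj G F) w
    safe⇒¬isolated F {w} crowd =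
      let t , t≢w , walk = crowd-avoiding k>0 crowd w
          _ , wv = walk⇒neighbour walk (≢-sym t≢w)
      in neighbour⇒¬isolated {H = flipAdj G F} wv

    walkWithinX : ∀ {z t} → z ∈ₛ X → t ∈ₛ X → Walk (adj G) 2 z t
    walkWithinX {z} {t} z∈X t∈X with z ≟ t
    ... | yes refl = stay
    ... | no z≢t   = let _ , wz , wt , _ = pairWitness z∈X t∈X z≢t in
                     step (trans (adj-sym G z _) wz) (step wt stay)

    safeStart : ∃ λ z → Safe (adj G) z
    safeStart =
      let z , z∈X = member X (≤-trans (s≤s z≤n) big) in
      z , record { members = elements X
                 ; many = ≤-trans (s≤s (≤-trans (m≤n*m k 8) (m≤n+m (8 * k) 2)))
                                  (≤-trans big (≤-reflexive (sym (length-elements X))))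
                 ; unique = Unique-elements X
                 ; inX = All.tabulate (∈-elements⁻ X)
                 ; property = All.tabulate (walkWithinX z∈X ∘ ∈-elements⁻ X) }

  bound : TwoShattered G X → 0 < k → FlipperWins 2 k G → ∣ X ∣ ≤ 8 * k + 2
  bound twoShattered k>0 wins with ∣ X ∣ ≤? 8 * k + 2
  ... | yes small = small
  ... | no ¬small = ⊥-elim (flipperLoses Safe escape safe⇒¬isolated (proj₂ safeStart) wins)
    where open Runner twoShattered k>0 (subst (_≤ ∣ X ∣) (cong suc (+-comm (8 * k) 2)) (≰⇒> ¬small))

emptyAtWidth0 : ∀ {G r} → FlipperWins r 0 G → (X : Subset (n G)) → ∣ X ∣ ≡ 0
emptyAtWidth0 wins X with ∣ X ∣ in size
... | zero  = refl
... | suc _ = ⊥-elim (noVertices wins (proj₁ (member X (subst (0 <_) (sym size) (s≤s z≤n)))))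

mainTheorem11 : (G : Graph) →
    ((k : ℕ) → FlipperWins 1 k G →
       (X : Subset (n G)) → Shattered G X → ∣ X ∣ ≤ 8 * k)
    × ((k : ℕ) → FlipperWins 2 k G →
       (X : Subset (n G)) → TwoShattered G X → ∣ X ∣ ≤ 8 * k + 2)
mainTheorem11 G = vc , twoVC
  where
  vc : (k : ℕ) → FlipperWins 1 k G → (X : Subset (n G)) → Shattered G X → ∣ X ∣ ≤ 8 * k
  vc zero        wins X _          = ≤-reflexive (emptyAtWidth0 wins X)
  vc k@(suc _)   wins X shattered  = VCdimension.bound G X k shattered (s≤s z≤n) wins
  twoVC : (k : ℕ) → FlipperWins 2 k G → (X : Subset (n G)) → TwoShattered G X → ∣ X ∣ ≤ 8 * k + 2
  twoVC zero      wins X _            = ≤-trans (≤-reflexive (emptyAtWidth0 wins X)) z≤n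
  twoVC k@(suc _) wins X twoShattered = TwoVCdimension.bound G X k twoShattered (s≤s z≤n) wins
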